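{- For every integer $n \ge 3$ there exists an $n$-Venn polyomino (as defined in the context) of area $2^n + 2^{n-1} - 4$. In particular its area is less than $\tfrac{3}{2}(2^n - 1)$, i.e., less than $3/2$ times the minimum possible area $2^n-1$.
   Context: A polyomino is a finite, edge-connected set of unit squares (cells) of the integer lattice $\mathbb{Z}^2$; two cells are adjacent iff they share an edge. An $n$-Venn diagram is a family of $n$ simple closed curves $C_1,\dots,C_n$ in the plane such that, for every subset $S \subseteq \{1,\dots,n\}$, the set of points lying inside exactly the curves $C_i$ with $i \in S$ (and outside all others) is nonempty and connected. An $n$-Venn polyomino is an $n$-Venn diagram in which each curve $C_i$ is the boundary of a hole-free polyomino $P_i$, all polyominoes being placed on the same unit grid. Equivalently, it is an orthogonal unit-grid drawing of an $n$-Venn diagram. The area of an $n$-Venn polyomino is the number of cells in $P_1 \cup \dots \cup P_n$. Every bounded region contains at least one cell, so the area is at least $2^n - 1$. -}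

module Defs where

open import Data.Nat using (ℕ)
open import Data.Integer using (ℤ; _+_; _-_; 1ℤ)
open import Data.Product using (Σ; ∃; _×_; _,_)
open import Data.Sum using (_⊎_)
open import Data.Empty using (⊥)
open import Data.Fin using (Fin)
open import Data.Fin.Subset using (Subset) renaming (_∈_ to _∈ₛ_)
open import Data.List using (List; length; _∷_)
open import Data.List.Membership.Propositional using (_∈_; _∉_)
open import Data.List.Relation.Unary.Unique.Propositional using (Unique)
open import Relation.Binary.PropositionalEquality using (_≡_)
open import Relation.Nullary using (¬_)

-- A cell of the unit grid, identified by the integer coordinates of its
-- lower-left corner: cell (x , y) is the open square (x,x+1) × (y,y+1).
Cell : Set
Cell = ℤ × ℤ

Adjacent : Cell → Cell → Set
Adjacent (x , y) (x' , y') =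
  (x ≡ x' × (y' ≡ y + 1ℤ ⊎ y ≡ y' + 1ℤ)) ⊎
  (y ≡ y' × (x' ≡ x + 1ℤ ⊎ x ≡ x' + 1ℤ))

data Path (A : Cell → Set) : Cell → Cell → Set where
  here : ∀ {c} → A c → Path A c c
  step : ∀ {c c' d} → A c → Adjacent c c' → Path A c' d → Path A c d

EdgeConnected : (Cell → Set) → Set
EdgeConnected A = ∀ c d → A c → A d → Path A c d

-- A finite set of cells is represented by a list (duplicates irrelevant).
InP : List Cell → Cell → Set
InP P c = c ∈ P

OutP : List Cell → Cell → Set
OutP P c = c ∉ P

-- Checkerboard ("pinch") vertex: at grid vertex (x , y) the four surrounding
-- cells are alternately in / out of P, diagonally.
Pinch : List Cell → ℤ → ℤ → Set
Pinch P x y =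
  (((x - 1ℤ) , (y - 1ℤ)) ∈ P × (x , y) ∈ P × (x , (y - 1ℤ)) ∉ P × ((x - 1ℤ) , y) ∉ P) ⊎
  (((x - 1ℤ) , (y - 1ℤ)) ∉ P × (x , y) ∉ P × (x , (y - 1ℤ)) ∈ P × ((x - 1ℤ) , y) ∈ P)

-- A hole-free polyomino whose boundary is a simple closed curve:
-- nonempty, edge-connected, complement edge-connected (hole-free), and no
-- pinch vertex (so the boundary does not touch itself).
IsSimplePolyomino : List Cell → Set
IsSimplePolyomino P =
  (∃ λ c → c ∈ P) ×
  EdgeConnected (InP P) ×
  EdgeConnected (OutP P) ×
  (∀ x y → ¬ Pinch P x y)

InRegion : ∀ {n} → (Fin n → List Cell) → Subset n → Cell → Set
InRegion P S c = ∀ i → (c ∈ P i → i ∈ₛ S) × (i ∈ₛ S → c ∈ P i)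

IsVenn : ∀ {n} → (Fin n → List Cell) → Set
IsVenn {n} P = ∀ (S : Subset n) →
  (∃ λ c → InRegion P S c) × EdgeConnected (InRegion P S)

IsVennPolyomino : ∀ {n} → (Fin n → List Cell) → Set
IsVennPolyomino P = (∀ i → IsSimplePolyomino (P i)) × IsVenn P

HasArea : ∀ {n} → (Fin n → List Cell) → ℕ → Set
HasArea P k = Σ (List Cell) λ U →
  Unique U × (∀ c → (c ∈ U → ∃ λ i → c ∈ P i) × ((∃ λ i → c ∈ P i) → c ∈ U)) ×
  length U ≡ k

module Submission where

-- Number the curves 0 … m and label each cell by the set of curves containing it.
-- Row 1 holds 2 ^ m cells, column x labelled {0} ∪ {j + 1 | bit j of x is set}.
-- Row 0 holds columns 1 … B, column x labelled {j + 1 | 2 ^ j ≤ x}: an initial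
-- segment of the curves 1 … m growing with x, so each such region is an interval of
-- row 0. Every other region gets a single cell in row 2, above the row-1 cell with
-- the same lower bits. Since bit j of x forces 2 ^ j ≤ x, curve j + 1 is a histogram
-- standing on an interval of row 0 and curve 0 is a bar, so no curve has holes or
-- pinch points, and every complementary region escapes the three-row strip
-- vertically. With 2 ^ m - (m + 1) non-initial segments the area is
-- B + 2 * 2 ^ m - (m + 1).

open import Defs
open import Data.Bool using (true; false)
import Data.Bool as Bool
open import Data.Nat
  using (ℕ; zero; suc; _+_; _*_; _∸_; _^_; _≤_; _<_; _≤′_; ≤′-refl; ≤′-step; z≤n; s≤s; pred; ⌊_/2⌋)
open import Data.Nat.Properties
  using ( _<?_; _≤?_; ≤-refl; ≤-trans; ≤-total; ≤-<-trans; ≤⇒≤′; ≤′⇒≤; n≤1+n; <⇒≤pred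
        ; +-comm; +-assoc; +-identityʳ; 1+n≢n; *-comm; *-monoˡ-≤; *-cancelʳ-<; n<1⇒n≡0; ⌊n/2⌋-mono
        ; +-cancelʳ-≡; m+n∸n≡m; m<m+n; m≤m+n; m+n≡0⇒n≡0; m^n>0 )
open import Data.Nat.Tactic.RingSolver using (solve-∀)
open import Data.Integer as ℤ using (ℤ; +_; -[1+_]; 0ℤ; 1ℤ; -1ℤ)
import Data.Integer.Properties as ℤ
open import Data.Fin using (Fin; zero; suc)
open import Data.Fin.Subset using (Subset; Side; inside; outside; ⊥; ⊤; _⊆_; Nonempty)
  renaming (_∈_ to _∈ₛ_; _∉_ to _∉ₛ_)
open import Data.Fin.Subset.Properties
  using (_∈?_; ⊥⊆; s⊆s; out⊆; ⊆-refl; ⊆-antisym; ∉⊥; ∈⊤; drop-there; Empty-unique; nonempty?)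
open import Data.Vec using ([]; _∷_; here; there)
open import Data.Vec.Properties using (≡-dec; ∷-injectiveʳ)
open import Data.List using (List; []; _∷_; map; _++_; length; filter; upTo)
open import Data.List.Properties
  using (length-map; length-++; length-upTo; filter-++; filter-all; filter-≐)
open import Data.List.Relation.Unary.All using ([]; universal)
open import Data.List.Relation.Unary.Any using (here)
open import Data.List.Membership.Propositional using (_∈_; _∉_)
open import Data.List.Membership.Propositional.Properties
  using (∈-map⁺; ∈-map⁻; ∈-++⁺ˡ; ∈-++⁺ʳ; ∈-++⁻; ∈-upTo⁺; ∈-upTo⁻; ∈-filter⁺; ∈-filter⁻)
open import Data.List.Relation.Unary.Unique.Propositional using (Unique; []; _∷_)
import Data.List.Relation.Unary.Unique.Propositional.Properties as Unique
open import Data.List.Relation.Binary.Disjoint.Propositional using (Disjoint)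
open import Data.Product using (Σ; ∃; _×_; _,_; proj₁; proj₂)
open import Data.Sum using (_⊎_; inj₁; inj₂; map₁)
open import Function using (_∘_)
open import Relation.Nullary using (¬_; yes; no; does; ¬?; map′; contradiction)
open import Relation.Unary using (Pred; Decidable; _≐_)
open import Relation.Binary.PropositionalEquality
  using (_≡_; _≢_; refl; sym; trans; cong; cong₂; subst; module ≡-Reasoning)

private
  variable
    A B : Cell → Set
    c d e : Cell
    m : ℕ
    p q : Subset m

-- Paths and connectivity

Adjacent-sym : Adjacent c d → Adjacent d c
Adjacent-sym (inj₁ (refl , inj₁ eq)) = inj₁ (refl , inj₂ eq)
Adjacent-sym (inj₁ (refl , inj₂ eq)) = inj₁ (refl , inj₁ eq)
Adjacent-sym (inj₂ (refl , inj₁ eq)) = inj₂ (refl , inj₂ eq)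
Adjacent-sym (inj₂ (refl , inj₂ eq)) = inj₂ (refl , inj₁ eq)

source : Path A c d → A c
source (here a) = a
source (step a _ _) = a

target : Path A c d → A d
target (here a) = a
target (step _ _ p) = target p

_++ᵖ_ : Path A c d → Path A d e → Path A c e
here _ ++ᵖ q = q
step a adj p ++ᵖ q = step a adj (p ++ᵖ q)

reverseᵖ : Path A c d → Path A d c
reverseᵖ (here a) = here a
reverseᵖ (step a adj p) = reverseᵖ p ++ᵖ step (source p) (Adjacent-sym adj) (here a)

mapᵖ : (∀ {c} → A c → B c) → Path A c d → Path B c d
mapᵖ f (here a) = here (f a)
mapᵖ f (step a adj p) = step (f a) adj (mapᵖ f p)

EdgeConnected-resp : (∀ {c} → A c → B c) → (∀ {c} → B c → A c) → EdgeConnected A → EdgeConnected B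
EdgeConnected-resp A⇒B B⇒A conn c d bc bd = mapᵖ A⇒B (conn c d (B⇒A bc) (B⇒A bd))

+[1+n]≡+n+1 : ∀ n → + suc n ≡ + n ℤ.+ 1ℤ
+[1+n]≡+n+1 n = cong +_ (+-comm 1 n)

line-path : (f : ℤ → Cell) → (∀ z → Adjacent (f z) (f (z ℤ.+ 1ℤ))) → (∀ z → A (f z)) →
            ∀ z z′ → Path A (f z) (f z′)
line-path {A = A} f adj inA z z′ = toOrigin z ++ᵖ reverseᵖ (toOrigin z′)
  where
  toOrigin : ∀ z → Path A (f z) (f 0ℤ)
  toOrigin (+ zero) = here (inA _)
  toOrigin (+ suc n) =
    step (inA _) (Adjacent-sym (subst (λ w → Adjacent (f (+ n)) (f w)) (sym (+[1+n]≡+n+1 n)) (adj (+ n))))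
      (toOrigin (+ n))
  toOrigin -[1+ zero ] = step (inA _) (adj -[1+ 0 ]) (here (inA _))
  toOrigin -[1+ suc n ] = step (inA _) (adj -[1+ suc n ]) (toOrigin -[1+ n ])

Adjacent-right : ∀ x y → Adjacent (+ x , y) (+ suc x , y)
Adjacent-right x y = inj₂ (refl , inj₁ (+[1+n]≡+n+1 x))

RowConvex : (Cell → Set) → ℤ → Set
RowConvex A y = ∀ {a k b} → a ≤ k → k ≤ b → A (+ a , y) → A (+ b , y) → A (+ k , y)

segment : ∀ {y a b} → (∀ {k} → a ≤ k → k ≤ b → A (+ k , y)) → a ≤′ b → Path A (+ a , y) (+ b , y)
segment inA ≤′-refl = here (inA ≤-refl ≤-refl)
segment {y = y} inA (≤′-step {n} a≤′n) =
  segment (λ a≤k k≤n → inA a≤k (≤-trans k≤n (n≤1+n n))) a≤′n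
    ++ᵖ step (inA (≤′⇒≤ a≤′n) (n≤1+n n)) (Adjacent-right n y) (here (inA (≤′⇒≤ (≤′-step a≤′n)) ≤-refl))

row-path : ∀ {y a b} → RowConvex A y → A (+ a , y) → A (+ b , y) → Path A (+ a , y) (+ b , y)
row-path {a = a} {b} convex inA inB with ≤-total a b
... | inj₁ a≤b = segment (λ a≤k k≤b → convex a≤k k≤b inA inB) (≤⇒≤′ a≤b)
... | inj₂ b≤a = reverseᵖ (segment (λ b≤k k≤a → convex b≤k k≤a inB inA) (≤⇒≤′ b≤a))

EdgeConnected-via-row : ∀ y → RowConvex A y → (∀ {c} → A c → ∃ λ x → Path A c (+ x , y)) →
                        EdgeConnected A
EdgeConnected-via-row y convex reach c d ac ad with reach ac | reach ad
... | _ , p | _ , q = p ++ᵖ (row-path convex (target p) (target q) ++ᵖ reverseᵖ q)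

data Frame : Cell → Set where
  below : ∀ x n → Frame (x , -[1+ n ])
  above : ∀ x n → Frame (x , + (3 + n))
  left  : ∀ n y → Frame (-[1+ n ] , y)

Frame-connected : EdgeConnected Frame
Frame-connected c d fc fd = toHub fc ++ᵖ reverseᵖ (toHub fd)
  where
  hub : Cell
  hub = (-1ℤ , -1ℤ)

  alongRow : ∀ y → (∀ x → Frame (x , y)) → ∀ x → Path Frame (x , y) hub
  alongRow y full x =
    line-path (_, y) (λ _ → inj₂ (refl , inj₁ refl)) full x -1ℤ
      ++ᵖ line-path (-1ℤ ,_) (λ _ → inj₁ (refl , inj₁ refl)) (left 0) y -1ℤ

  toHub : ∀ {c} → Frame c → Path Frame c hub
  toHub (below x n) = alongRow -[1+ n ] (λ x → below x n) x
  toHub (above x n) = alongRow (+ (3 + n)) (λ x → above x n) x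
  toHub (left n y) =
    line-path (-[1+ n ] ,_) (λ _ → inj₁ (refl , inj₁ refl)) (left n) y -1ℤ
      ++ᵖ alongRow -1ℤ (λ x → below x 0) -[1+ n ]

EdgeConnected-via : ∀ {C : Cell → Set} → (∀ {c} → C c → A c) → EdgeConnected C →
                    (∀ {c} → A c → ∃ λ c′ → C c′ × Path A c c′) → EdgeConnected A
EdgeConnected-via C⇒A conn reach c d ac ad with reach ac | reach ad
... | c′ , cc , p | d′ , cd , q = p ++ᵖ (mapᵖ C⇒A (conn c′ d′ cc cd) ++ᵖ reverseᵖ q)

strip-connected : (∀ {c} → Frame c → A c) → (∀ {x} → A (+ x , + 1) → A (+ x , + 2)) → EdgeConnected A
strip-connected {A = A} frame up = EdgeConnected-via frame Frame-connected (toFrame _)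
  where
  upward : ∀ {x y} → A (x , y) → Frame (x , y ℤ.+ 1ℤ) → Path A (x , y) (x , y ℤ.+ 1ℤ)
  upward a f = step a (inj₁ (refl , inj₁ refl)) (here (frame f))

  toFrame : ∀ c → A c → ∃ λ c′ → Frame c′ × Path A c c′
  toFrame (-[1+ n ] , y) a = _ , left n y , here a
  toFrame (+ x , -[1+ n ]) a = _ , below (+ x) n , here a
  toFrame (+ x , + 0) a = _ , below (+ x) 0 , step a (inj₁ (refl , inj₂ refl)) (here (frame (below (+ x) 0)))
  toFrame (+ x , + 1) a = _ , above (+ x) 0 , step a (inj₁ (refl , inj₁ refl)) (upward (up a) (above (+ x) 0))
  toFrame (+ x , + 2) a = _ , above (+ x) 0 , upward a (above (+ x) 0)
  toFrame (+ x , + suc (suc (suc n))) a = _ , above (+ x) n , here a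

-- Pinch points

z-1≢z : ∀ z → z ℤ.- 1ℤ ≢ z
z-1≢z (+ zero) ()
z-1≢z (+ suc n) ()
z-1≢z -[1+ n ] eq = 1+n≢n (trans (cong suc (sym (+-identityʳ n))) (ℤ.-[1+-injective eq))

no-pinch-in-row : ∀ {P : List Cell} r → (∀ {c} → c ∈ P → proj₂ c ≡ r) → ∀ x y → ¬ Pinch P x y
no-pinch-in-row r inRow x y (inj₁ (a , b , _ , _)) = z-1≢z y (trans (inRow a) (sym (inRow b)))
no-pinch-in-row r inRow x y (inj₂ (_ , _ , a , b)) = z-1≢z y (trans (inRow a) (sym (inRow b)))

no-pinch-downward : ∀ {P : List Cell} → (∀ {x y} → (x , y) ∈ P → (x , y ℤ.- 1ℤ) ∈ P ⊎ y ≡ 0ℤ) →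
                    (∀ {x} → (x , -1ℤ) ∉ P) → ∀ x y → ¬ Pinch P x y
no-pinch-downward down floor x y (inj₁ (a , b , c , _)) with down b
... | inj₁ under = c under
... | inj₂ refl = floor a
no-pinch-downward down floor x y (inj₂ (a , _ , c , d)) with down d
... | inj₁ under = a under
... | inj₂ refl = floor c

-- Binary expansions and initial segments

lsb : ℕ → Side
lsb zero = outside
lsb (suc zero) = inside
lsb (suc (suc x)) = lsb x

consBit : Side → ℕ → ℕ
consBit outside q = q * 2
consBit inside q = suc (q * 2)

val : Subset m → ℕ
val [] = 0
val (s ∷ p) = consBit s (val p)

bits : (m : ℕ) → ℕ → Subset m
bits zero x = []
bits (suc m) x = lsb x ∷ bits m ⌊ x /2⌋

consBit-suc : ∀ s q → consBit s (suc q) ≡ suc (suc (consBit s q))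
consBit-suc outside q = refl
consBit-suc inside q = refl

consBit-lsb : ∀ x → consBit (lsb x) ⌊ x /2⌋ ≡ x
consBit-lsb zero = refl
consBit-lsb (suc zero) = refl
consBit-lsb (suc (suc x)) = trans (consBit-suc (lsb x) ⌊ x /2⌋) (cong (λ n → suc (suc n)) (consBit-lsb x))

lsb-consBit : ∀ s q → lsb (consBit s q) ≡ s
lsb-consBit outside zero = refl
lsb-consBit inside zero = refl
lsb-consBit s (suc q) = trans (cong lsb (consBit-suc s q)) (lsb-consBit s q)

⌊consBit/2⌋ : ∀ s q → ⌊ consBit s q /2⌋ ≡ q
⌊consBit/2⌋ outside zero = refl
⌊consBit/2⌋ inside zero = refl
⌊consBit/2⌋ s (suc q) = trans (cong ⌊_/2⌋ (consBit-suc s q)) (cong suc (⌊consBit/2⌋ s q))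

q*2≤consBit : ∀ s q → q * 2 ≤ consBit s q
q*2≤consBit outside q = ≤-refl
q*2≤consBit inside q = n≤1+n (q * 2)

consBit<*2 : ∀ s {q r} → q < r → consBit s q < r * 2
consBit<*2 outside q<r = ≤-trans (n≤1+n _) (*-monoˡ-≤ 2 q<r)
consBit<*2 inside q<r = *-monoˡ-≤ 2 q<r

⌊/2⌋<⇐<*2 : ∀ {x q} → x < q * 2 → ⌊ x /2⌋ < q
⌊/2⌋<⇐<*2 {x} {q} x<2q =
  *-cancelʳ-< 2 ⌊ x /2⌋ q
    (≤-trans (s≤s (subst (⌊ x /2⌋ * 2 ≤_) (consBit-lsb x) (q*2≤consBit (lsb x) ⌊ x /2⌋))) x<2q)

2^[1+m]≡2^m*2 : ∀ m → 2 ^ suc m ≡ 2 ^ m * 2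
2^[1+m]≡2^m*2 m = *-comm 2 (2 ^ m)

val<2^m : (p : Subset m) → val p < 2 ^ m
val<2^m [] = s≤s z≤n
val<2^m {suc m} (s ∷ p) = subst (consBit s (val p) <_) (sym (2^[1+m]≡2^m*2 m)) (consBit<*2 s (val<2^m p))

bits-val : (p : Subset m) → bits m (val p) ≡ p
bits-val [] = refl
bits-val (s ∷ p) =
  cong₂ _∷_ (lsb-consBit s (val p)) (trans (cong (bits _) (⌊consBit/2⌋ s (val p))) (bits-val p))

val-bits : ∀ m {x} → x < 2 ^ m → val (bits m x) ≡ x
val-bits zero x<1 = sym (n<1⇒n≡0 x<1)
val-bits (suc m) {x} x<2^[1+m] =
  trans (cong (consBit (lsb x)) (val-bits m (⌊/2⌋<⇐<*2 (subst (x <_) (2^[1+m]≡2^m*2 m) x<2^[1+m]))))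
        (consBit-lsb x)

val-injective : val p ≡ val q → p ≡ q
val-injective {p = p} {q} eq = trans (sym (bits-val p)) (trans (cong (bits _) eq) (bits-val q))

bits-injective : ∀ m {x y} → x < 2 ^ m → y < 2 ^ m → bits m x ≡ bits m y → x ≡ y
bits-injective m x< y< eq = trans (sym (val-bits m x<)) (trans (cong val eq) (val-bits m y<))

bits-zero : ∀ m → bits m 0 ≡ ⊥
bits-zero zero = refl
bits-zero (suc m) = cong (outside ∷_) (bits-zero m)

-- j ∈ threshold m x iff 2 ^ j ≤ x.
threshold : (m : ℕ) → ℕ → Subset m
threshold zero x = []
threshold (suc m) zero = ⊥
threshold (suc m) (suc x) = inside ∷ threshold m ⌊ suc x /2⌋

threshold-zero : ∀ m → threshold m 0 ≡ ⊥
threshold-zero zero = refl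
threshold-zero (suc m) = refl

threshold-mono : ∀ m {x y} → x ≤ y → threshold m x ⊆ threshold m y
threshold-mono zero _ ()
threshold-mono (suc m) {zero} _ = ⊥⊆
threshold-mono (suc m) {suc x} (s≤s x≤y) = s⊆s (threshold-mono m (⌊n/2⌋-mono (s≤s x≤y)))

threshold-convex : ∀ m {a k b} → a ≤ k → k ≤ b →
                   threshold m a ≡ threshold m b → threshold m k ≡ threshold m a
threshold-convex m a≤k k≤b eq =
  ⊆-antisym (λ {j} j∈ → subst (j ∈ₛ_) (sym eq) (threshold-mono m k≤b j∈)) (threshold-mono m a≤k)

threshold-suc-nonempty : 0 < m → ∀ x → Nonempty (threshold m (suc x))
threshold-suc-nonempty {suc m} _ x = zero , here

bits⊆threshold : ∀ m x → bits m x ⊆ threshold m x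
bits⊆threshold zero x ()
bits⊆threshold (suc m) zero {j} j∈ = subst (j ∈ₛ_) (bits-zero (suc m)) j∈
bits⊆threshold (suc m) (suc x) {zero} _ = here
bits⊆threshold (suc m) (suc x) {suc j} j∈ = there (bits⊆threshold m ⌊ suc x /2⌋ (drop-there j∈))

data InitialSegment : Subset m → Set where
  ⊥-initial : InitialSegment (⊥ {m})
  inside∷ : InitialSegment p → InitialSegment (inside ∷ p)

initialSegment? : Decidable (InitialSegment {m})
initialSegment? [] = yes ⊥-initial
initialSegment? (inside ∷ p) = map′ inside∷ (λ { (inside∷ i) → i }) (initialSegment? p)
initialSegment? (outside ∷ p) = map′ (λ { refl → ⊥-initial }) (λ { ⊥-initial → refl }) (≡-dec Bool._≟_ p ⊥)

threshold-initial : ∀ m x → InitialSegment (threshold m x)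
threshold-initial zero x = ⊥-initial
threshold-initial (suc m) zero = ⊥-initial
threshold-initial (suc m) (suc x) = inside∷ (threshold-initial m _)

val-⊥ : ∀ m → val (⊥ {m}) ≡ 0
val-⊥ zero = refl
val-⊥ (suc m) = cong (_* 2) (val-⊥ m)

threshold-val : InitialSegment p → threshold m (val p) ≡ p
threshold-val {m = m} ⊥-initial = trans (cong (threshold m) (val-⊥ m)) (threshold-zero m)
threshold-val {p = inside ∷ p} (inside∷ i) =
  cong (inside ∷_) (trans (cong (threshold _) (⌊consBit/2⌋ inside (val p))) (threshold-val i))

Nonempty-outside∷⁺ : Nonempty p → Nonempty (outside ∷ p)
Nonempty-outside∷⁺ (j , j∈) = suc j , there j∈

Nonempty-outside∷⁻ : Nonempty (outside ∷ p) → Nonempty p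
Nonempty-outside∷⁻ (suc j , j∈) = j , drop-there j∈

¬initial⇒nonempty : ¬ InitialSegment p → Nonempty p
¬initial⇒nonempty {p = p} ¬i with nonempty? p
... | yes ne = ne
... | no empty = contradiction (subst InitialSegment (sym (Empty-unique empty)) ⊥-initial) ¬i

-- Counting subsets

module _ {a b} {A : Set a} {B : Set b} where

  filter-map : ∀ {ℓ} {P : Pred B ℓ} (P? : Decidable P) (f : A → B) xs →
               filter P? (map f xs) ≡ map f (filter (P? ∘ f) xs)
  filter-map P? f [] = refl
  filter-map P? f (x ∷ xs) with does (P? (f x))
  ... | true = cong (f x ∷_) (filter-map P? f xs)
  ... | false = filter-map P? f xs

map-Disjoint : ∀ {a b c} {A : Set a} {B : Set b} {C : Set c} {f : A → C} {g : B → C} {xs ys} →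
               (∀ x y → f x ≢ g y) → Disjoint (map f xs) (map g ys)
map-Disjoint f≢g (u∈ , v∈) with ∈-map⁻ _ u∈ | ∈-map⁻ _ v∈
... | x , _ , refl | y , _ , eq = f≢g x y eq

subsets : ∀ m → List (Subset m)
subsets zero = [] ∷ []
subsets (suc m) = map (inside ∷_) (subsets m) ++ map (outside ∷_) (subsets m)

∈-subsets : (p : Subset m) → p ∈ subsets m
∈-subsets [] = here refl
∈-subsets (inside ∷ p) = ∈-++⁺ˡ (∈-map⁺ (inside ∷_) (∈-subsets p))
∈-subsets {suc m} (outside ∷ p) = ∈-++⁺ʳ (map (inside ∷_) (subsets m)) (∈-map⁺ (outside ∷_) (∈-subsets p))

subsets-unique : ∀ m → Unique (subsets m)
subsets-unique zero = [] ∷ []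
subsets-unique (suc m) =
  Unique.++⁺ (Unique.map⁺ ∷-injectiveʳ (subsets-unique m)) (Unique.map⁺ ∷-injectiveʳ (subsets-unique m))
             (map-Disjoint (λ _ _ ()))

length-subsets : ∀ m → length (subsets m) ≡ 2 ^ m
length-subsets zero = refl
length-subsets (suc m) = begin
  length (map (inside ∷_) (subsets m) ++ map (outside ∷_) (subsets m))
    ≡⟨ length-++ (map (inside ∷_) (subsets m)) ⟩
  length (map (inside ∷_) (subsets m)) + length (map (outside ∷_) (subsets m))
    ≡⟨ cong₂ _+_ (length-map _ (subsets m)) (length-map _ (subsets m)) ⟩
  length (subsets m) + length (subsets m)
    ≡⟨ cong₂ _+_ (length-subsets m) (trans (length-subsets m) (sym (+-identityʳ _))) ⟩
  2 ^ suc m ∎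
  where open ≡-Reasoning

count : ∀ m {ℓ} {P : Pred (Subset m) ℓ} → Decidable P → ℕ
count m P? = length (filter P? (subsets m))

count-suc : ∀ m {ℓ} {P : Pred (Subset (suc m)) ℓ} (P? : Decidable P) →
            count (suc m) P? ≡ count m (P? ∘ (inside ∷_)) + count m (P? ∘ (outside ∷_))
count-suc m P? = begin
  length (filter P? (map (inside ∷_) (subsets m) ++ map (outside ∷_) (subsets m)))
    ≡⟨ cong length (filter-++ P? (map (inside ∷_) (subsets m)) _) ⟩
  length (filter P? (map (inside ∷_) (subsets m)) ++ filter P? (map (outside ∷_) (subsets m)))
    ≡⟨ length-++ (filter P? (map (inside ∷_) (subsets m))) ⟩
  length (filter P? (map (inside ∷_) (subsets m))) + length (filter P? (map (outside ∷_) (subsets m)))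
    ≡⟨ cong₂ _+_ (count-map (inside ∷_)) (count-map (outside ∷_)) ⟩
  count m (P? ∘ (inside ∷_)) + count m (P? ∘ (outside ∷_)) ∎
  where
  open ≡-Reasoning
  count-map : (f : Subset m → Subset (suc m)) → length (filter P? (map f (subsets m))) ≡ count m (P? ∘ f)
  count-map f = trans (cong length (filter-map P? f (subsets m))) (length-map f (filter (P? ∘ f) (subsets m)))

count-≐ : ∀ m {ℓ} {P Q : Pred (Subset m) ℓ} (P? : Decidable P) (Q? : Decidable Q) →
          P ≐ Q → count m P? ≡ count m Q?
count-≐ m P? Q? P≐Q = cong length (filter-≐ P? Q? P≐Q (subsets m))

count-all : ∀ m {ℓ} {P : Pred (Subset m) ℓ} (P? : Decidable P) → (∀ p → P p) → count m P? ≡ 2 ^ m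
count-all m P? all = trans (cong length (filter-all P? (universal all (subsets m)))) (length-subsets m)

count-nonempty : ∀ m → count m nonempty? + 1 ≡ 2 ^ m
count-nonempty zero = refl
count-nonempty (suc m) = begin
  count (suc m) nonempty? + 1
    ≡⟨ cong (_+ 1) (count-suc m nonempty?) ⟩
  count m (nonempty? ∘ (inside ∷_)) + count m (nonempty? ∘ (outside ∷_)) + 1
    ≡⟨ cong₂ (λ a b → a + b + 1) (count-all m _ (λ _ → zero , here))
                                 (count-≐ m _ nonempty? (Nonempty-outside∷⁻ , Nonempty-outside∷⁺)) ⟩
  2 ^ m + count m nonempty? + 1
    ≡⟨ +-assoc (2 ^ m) _ 1 ⟩
  2 ^ m + (count m nonempty? + 1)
    ≡⟨ cong (λ t → 2 ^ m + t) (trans (count-nonempty m) (sym (+-identityʳ _))) ⟩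
  2 ^ suc m ∎
  where open ≡-Reasoning

count-nonInitial : ∀ m → count m (¬? ∘ initialSegment?) + suc m ≡ 2 ^ m
count-nonInitial zero = refl
count-nonInitial (suc m) = begin
  count (suc m) (¬? ∘ initialSegment?) + suc (suc m)
    ≡⟨ cong (_+ suc (suc m)) (count-suc m (¬? ∘ initialSegment?)) ⟩
  count m (¬? ∘ initialSegment? ∘ (inside ∷_)) + count m (¬? ∘ initialSegment? ∘ (outside ∷_)) + suc (suc m)
    ≡⟨ cong₂ (λ a b → a + b + suc (suc m))
             (count-≐ m _ (¬? ∘ initialSegment?) ((_∘ inside∷) , λ { ¬i (inside∷ i) → ¬i i }))
             (count-≐ m _ nonempty?
               (Nonempty-outside∷⁻ ∘ ¬initial⇒nonempty , λ { (_ , j∈) ⊥-initial → ∉⊥ j∈ })) ⟩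
  a + b + suc (suc m)
    ≡⟨ shuffle a b m ⟩
  (a + suc m) + (b + 1)
    ≡⟨ cong₂ _+_ (count-nonInitial m) (trans (count-nonempty m) (sym (+-identityʳ _))) ⟩
  2 ^ suc m ∎
  where
  open ≡-Reasoning
  a b : ℕ
  a = count m (¬? ∘ initialSegment?)
  b = count m nonempty?
  shuffle : ∀ a b m → a + b + suc (suc m) ≡ (a + suc m) + (b + 1)
  shuffle = solve-∀

module Polyominoes {n : ℕ} (label : Cell → Subset n) (U : List Cell)
                   (U-complete : ∀ {c} → Nonempty (label c) → c ∈ U) where

  polyomino : Fin n → List Cell
  polyomino i = filter (λ c → i ∈? label c) U

  ∈-polyomino⁺ : ∀ {i c} → i ∈ₛ label c → c ∈ polyomino i
  ∈-polyomino⁺ {i} i∈ = ∈-filter⁺ (λ c → i ∈? label c) (U-complete (i , i∈)) i∈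

  ∈-polyomino⁻ : ∀ {i c} → c ∈ polyomino i → i ∈ₛ label c
  ∈-polyomino⁻ {i} c∈ = proj₂ (∈-filter⁻ (λ c → i ∈? label c) {xs = U} c∈)

  InRegion⇒label≡ : ∀ {S c} → InRegion polyomino S c → label c ≡ S
  InRegion⇒label≡ r = ⊆-antisym (λ i∈ → proj₁ (r _) (∈-polyomino⁺ i∈)) (λ i∈ → ∈-polyomino⁻ (proj₂ (r _) i∈))

  label≡⇒InRegion : ∀ {S c} → label c ≡ S → InRegion polyomino S c
  label≡⇒InRegion refl i = ∈-polyomino⁻ , ∈-polyomino⁺

  isVenn : (∀ S → ∃ λ c → label c ≡ S) → (∀ S → EdgeConnected (λ c → label c ≡ S)) → IsVenn polyomino
  isVenn nonempty connected S =
    (proj₁ (nonempty S) , label≡⇒InRegion (proj₂ (nonempty S))) ,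
    EdgeConnected-resp label≡⇒InRegion InRegion⇒label≡ (connected S)

  isSimplePolyomino : ∀ i → (∃ λ c → i ∈ₛ label c) → EdgeConnected (λ c → i ∈ₛ label c) →
                      EdgeConnected (λ c → i ∉ₛ label c) → (∀ x y → ¬ Pinch (polyomino i) x y) →
                      IsSimplePolyomino (polyomino i)
  isSimplePolyomino i (c , i∈) connected complement-connected no-pinch =
    (c , ∈-polyomino⁺ i∈) ,
    EdgeConnected-resp ∈-polyomino⁺ ∈-polyomino⁻ connected ,
    EdgeConnected-resp (λ i∉ c∈ → i∉ (∈-polyomino⁻ c∈)) (λ c∉ i∈ → c∉ (∈-polyomino⁺ i∈))
      complement-connected ,
    no-pinch

  polyomino⊆U : ∀ {i c} → c ∈ polyomino i → c ∈ U
  polyomino⊆U {i} c∈ = proj₁ (∈-filter⁻ (λ c → i ∈? label c) {xs = U} c∈)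

  hasArea : Unique U → (∀ {c} → c ∈ U → Nonempty (label c)) → HasArea polyomino (length U)
  hasArea unique U-sound = U , unique , (λ _ → covered , polyomino⊆U ∘ proj₂) , refl
    where
    covered : ∀ {c} → c ∈ U → ∃ λ i → c ∈ polyomino i
    covered c∈ = let (i , i∈) = U-sound c∈ in i , ∈-polyomino⁺ i∈

module Drawing (m B : ℕ) (2^m-1≤B : pred (2 ^ m) ≤ B) where

  W : ℕ
  W = 2 ^ m

  <W⇒≤B : ∀ {x} → x < W → x ≤ B
  <W⇒≤B x<W = ≤-trans (<⇒≤pred x<W) 2^m-1≤B

  label : Cell → Subset (suc m)
  label (+ x , + 0) with x ≤? B
  ... | yes _ = outside ∷ threshold m x
  ... | no _ = ⊥
  label (+ x , + 1) with x <? W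
  ... | yes _ = inside ∷ bits m x
  ... | no _ = ⊥
  label (+ x , + 2) with x <? W | initialSegment? (bits m x)
  ... | yes _ | no _ = outside ∷ bits m x
  ... | _ | _ = ⊥
  label _ = ⊥

  -- The lower part of each label is bound by an equation so that two cells with the same
  -- label can be matched jointly.
  data Drawn : Cell → Subset (suc m) → Set where
    bottom : ∀ {x p} → x ≤ B → threshold m x ≡ p → Drawn (+ x , + 0) (outside ∷ p)
    middle : ∀ {x p} → x < W → bits m x ≡ p → Drawn (+ x , + 1) (inside ∷ p)
    top    : ∀ {x p} → x < W → bits m x ≡ p → ¬ InitialSegment p → Drawn (+ x , + 2) (outside ∷ p)

  label-drawn : ∀ {c S} → Drawn c S → label c ≡ S
  label-drawn (bottom {x} x≤B refl) with x ≤? B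
  ... | yes _ = refl
  ... | no x≰B = contradiction x≤B x≰B
  label-drawn (middle {x} x<W refl) with x <? W
  ... | yes _ = refl
  ... | no x≮W = contradiction x<W x≮W
  label-drawn (top {x} x<W refl ¬i) with x <? W | initialSegment? (bits m x)
  ... | yes _ | no _ = refl
  ... | yes _ | yes i = contradiction i ¬i
  ... | no x≮W | _ = contradiction x<W x≮W

  drawn : ∀ c → Nonempty (label c) → Drawn c (label c)
  drawn (+ x , + 0) ne with x ≤? B
  ... | yes x≤B = bottom x≤B refl
  ... | no _ = contradiction (proj₂ ne) ∉⊥
  drawn (+ x , + 1) ne with x <? W
  ... | yes x<W = middle x<W refl
  ... | no _ = contradiction (proj₂ ne) ∉⊥
  drawn (+ x , + 2) ne with x <? W | initialSegment? (bits m x)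
  ... | yes x<W | no ¬i = top x<W refl ¬i
  ... | yes _ | yes _ = contradiction (proj₂ ne) ∉⊥
  ... | no _ | _ = contradiction (proj₂ ne) ∉⊥
  drawn (+ x , + suc (suc (suc _))) ne = contradiction (proj₂ ne) ∉⊥
  drawn (+ x , -[1+ _ ]) ne = contradiction (proj₂ ne) ∉⊥
  drawn (-[1+ _ ] , _) ne = contradiction (proj₂ ne) ∉⊥

  drawn-with : ∀ c {S} → label c ≡ S → Nonempty S → Drawn c S
  drawn-with c refl ne = drawn c ne

  label-Frame : ∀ {c} → Frame c → label c ≡ ⊥
  label-Frame (below (+ x) n) = refl
  label-Frame (below -[1+ x ] n) = refl
  label-Frame (above (+ x) n) = refl
  label-Frame (above -[1+ x ] n) = refl
  label-Frame (left n y) = refl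

  top⊆middle : ∀ x → label (+ x , + 2) ⊆ label (+ x , + 1)
  top⊆middle x i∈ = below-top (drawn (+ x , + 2) (_ , i∈)) i∈
    where
    below-top : ∀ {S} → Drawn (+ x , + 2) S → S ⊆ label (+ x , + 1)
    below-top (top x<W refl _) = subst (_ ⊆_) (sym (label-drawn (middle x<W refl))) (out⊆ ⊆-refl)

  middle⊆bottom : ∀ x {j} → suc j ∈ₛ label (+ x , + 1) → suc j ∈ₛ label (+ x , + 0)
  middle⊆bottom x j∈ = below-middle (drawn (+ x , + 1) (_ , j∈)) j∈
    where
    below-middle : ∀ {S j} → Drawn (+ x , + 1) S → suc j ∈ₛ S → suc j ∈ₛ label (+ x , + 0)
    below-middle (middle x<W refl) j∈ =
      subst (_ ∈ₛ_) (sym (label-drawn (bottom (<W⇒≤B x<W) refl)))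
        (there (bits⊆threshold m x (drop-there j∈)))

  region-nonempty : ∀ S → ∃ λ c → label c ≡ S
  region-nonempty (inside ∷ p) = (+ val p , + 1) , label-drawn (middle (val<2^m p) (bits-val p))
  region-nonempty (outside ∷ p) with initialSegment? p
  ... | yes i = (+ val p , + 0) , label-drawn (bottom (<W⇒≤B (val<2^m p)) (threshold-val i))
  ... | no ¬i = (+ val p , + 2) , label-drawn (top (val<2^m p) (bits-val p) ¬i)

  bottom-convex : ∀ {S} → Nonempty S → RowConvex (λ c → label c ≡ S) (+ 0)
  bottom-convex ne {a} {k} {b} a≤k k≤b eqa eqb
    with drawn-with (+ a , + 0) eqa ne | drawn-with (+ b , + 0) eqb ne
  ... | bottom _ refl | bottom b≤B tb≡ta =
    label-drawn (bottom (≤-trans k≤b b≤B) (threshold-convex m a≤k k≤b (sym tb≡ta)))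

  same-label-path : ∀ {S c d} → Nonempty S → Drawn c S → Drawn d S → Path (λ e → label e ≡ S) c d
  same-label-path ne c@(bottom _ _) d@(bottom _ _) =
    row-path (bottom-convex ne) (label-drawn c) (label-drawn d)
  same-label-path ne c@(middle a<W eqa) (middle b<W eqb) with bits-injective m a<W b<W (trans eqa (sym eqb))
  ... | refl = here (label-drawn c)
  same-label-path ne c@(top a<W eqa _) (top b<W eqb _) with bits-injective m a<W b<W (trans eqa (sym eqb))
  ... | refl = here (label-drawn c)
  same-label-path ne (bottom {a} _ eq) (top _ _ ¬i) =
    contradiction (subst InitialSegment eq (threshold-initial m a)) ¬i
  same-label-path ne (top _ _ ¬i) (bottom {b} _ eq) =
    contradiction (subst InitialSegment eq (threshold-initial m b)) ¬i

  region-connected : ∀ S → EdgeConnected (λ c → label c ≡ S)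
  region-connected S with nonempty? S
  ... | yes ne = λ c d eqc eqd → same-label-path ne (drawn-with c eqc ne) (drawn-with d eqd ne)
  ... | no empty rewrite Empty-unique empty = strip-connected label-Frame (λ {x} → top-empty x)
    where
    top-empty : ∀ x → label (+ x , + 1) ≡ ⊥ → label (+ x , + 2) ≡ ⊥
    top-empty x eq = ⊆-antisym (λ {i} i∈ → subst (i ∈ₛ_) eq (top⊆middle x i∈)) ⊥⊆

  curve-nonempty : ∀ i → ∃ λ c → i ∈ₛ label c
  curve-nonempty i =
    (+ val (⊤ {m}) , + 1) , subst (i ∈ₛ_) (sym (label-drawn (middle (val<2^m (⊤ {m})) (bits-val ⊤)))) ∈⊤

  curve-complement-connected : ∀ i → EdgeConnected (λ c → i ∉ₛ label c)
  curve-complement-connected i =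
    strip-connected (λ f i∈ → ∉⊥ (subst (i ∈ₛ_) (label-Frame f) i∈)) (λ {x} i∉ i∈ → i∉ (top⊆middle x i∈))

  curve₀-in-middle : ∀ {c} → zero ∈ₛ label c → ∃ λ x → c ≡ (+ x , + 1) × x < W
  curve₀-in-middle {c} z∈ = middle-of (drawn c (zero , z∈)) z∈
    where
    middle-of : ∀ {c S} → Drawn c S → zero ∈ₛ S → ∃ λ x → c ≡ (+ x , + 1) × x < W
    middle-of (middle {x} x<W _) _ = x , refl , x<W

  curve₀-row : ∀ {c} → zero ∈ₛ label c → proj₂ c ≡ + 1
  curve₀-row {c} z∈ with curve₀-in-middle {c} z∈
  ... | _ , refl , _ = refl

  curve₀-convex : RowConvex (λ c → zero ∈ₛ label c) (+ 1)
  curve₀-convex {b = b} _ k≤b _ zb with curve₀-in-middle {+ b , + 1} zb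
  ... | _ , refl , b<W = subst (zero ∈ₛ_) (sym (label-drawn (middle (≤-<-trans k≤b b<W) refl))) here

  curve₀-reach : ∀ {c} → zero ∈ₛ label c → ∃ λ x → Path (λ e → zero ∈ₛ label e) c (+ x , + 1)
  curve₀-reach {c} z∈ with curve₀-in-middle {c} z∈
  ... | x , refl , _ = x , here z∈

  downward : ∀ x y → Adjacent (x , y ℤ.+ 1ℤ) (x , y)
  downward x y = inj₁ (refl , inj₂ refl)

  curve-suc-downward : ∀ {j} x y → suc j ∈ₛ label (x , y) → suc j ∈ₛ label (x , y ℤ.- 1ℤ) ⊎ y ≡ 0ℤ
  curve-suc-downward (+ x) (+ 0) _ = inj₂ refl
  curve-suc-downward (+ x) (+ 1) j∈ = inj₁ (middle⊆bottom x j∈)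
  curve-suc-downward (+ x) (+ 2) j∈ = inj₁ (top⊆middle x j∈)
  curve-suc-downward (+ x) (+ suc (suc (suc _))) j∈ = contradiction j∈ ∉⊥
  curve-suc-downward (+ x) -[1+ _ ] j∈ = contradiction j∈ ∉⊥
  curve-suc-downward -[1+ _ ] y j∈ = contradiction j∈ ∉⊥

  curve-suc-reach : ∀ {j} c → suc j ∈ₛ label c → ∃ λ x → Path (λ e → suc j ∈ₛ label e) c (+ x , + 0)
  curve-suc-reach (+ x , + 0) j∈ = x , here j∈
  curve-suc-reach (+ x , + 1) j∈ = x , step j∈ (downward (+ x) (+ 0)) (here (middle⊆bottom x j∈))
  curve-suc-reach (+ x , + 2) j∈ =
    x , step j∈ (downward (+ x) (+ 1))
          (step (top⊆middle x j∈) (downward (+ x) (+ 0)) (here (middle⊆bottom x (top⊆middle x j∈))))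
  curve-suc-reach (+ x , + suc (suc (suc _))) j∈ = contradiction j∈ ∉⊥
  curve-suc-reach (+ x , -[1+ _ ]) j∈ = contradiction j∈ ∉⊥
  curve-suc-reach (-[1+ _ ] , y) j∈ = contradiction j∈ ∉⊥

  in-bottom-row : ∀ {x S} → Drawn (+ x , + 0) S → x ≤ B × S ≡ outside ∷ threshold m x
  in-bottom-row (bottom x≤B refl) = x≤B , refl

  curve-suc-convex : ∀ j → RowConvex (λ c → suc j ∈ₛ label c) (+ 0)
  curve-suc-convex j {a} {k} {b} a≤k k≤b ja jb
    with in-bottom-row (drawn (+ a , + 0) (_ , ja)) | in-bottom-row (drawn (+ b , + 0) (_ , jb))
  ... | _ , la | b≤B , _ =
    subst (suc j ∈ₛ_) (sym (label-drawn (bottom (≤-trans k≤b b≤B) refl)))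
      (there (threshold-mono m a≤k (drop-there (subst (suc j ∈ₛ_) la ja))))

  curve-connected : ∀ i → EdgeConnected (λ c → i ∈ₛ label c)
  curve-connected zero = EdgeConnected-via-row (+ 1) curve₀-convex curve₀-reach
  curve-connected (suc j) = EdgeConnected-via-row (+ 0) (curve-suc-convex j) (curve-suc-reach _)

  bottomCell : ℕ → Cell
  bottomCell x = (+ suc x , + 0)

  middleCell topCell : Subset m → Cell
  middleCell p = (+ val p , + 1)
  topCell p = (+ val p , + 2)

  U₀ U₁ U₂ U : List Cell
  U₀ = map bottomCell (upTo B)
  U₁ = map middleCell (subsets m)
  U₂ = map topCell (filter (¬? ∘ initialSegment?) (subsets m))
  U = U₀ ++ U₁ ++ U₂

  U-complete : ∀ {c} → Nonempty (label c) → c ∈ U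
  U-complete {c} ne = drawn-∈U (drawn c ne) ne
    where
    drawn-∈U : ∀ {c S} → Drawn c S → Nonempty S → c ∈ U
    drawn-∈U (bottom {zero} _ refl) (suc j , j∈) =
      contradiction (subst (j ∈ₛ_) (threshold-zero m) (drop-there j∈)) ∉⊥
    drawn-∈U (bottom {suc x} x<B _) _ = ∈-++⁺ˡ (∈-map⁺ bottomCell (∈-upTo⁺ x<B))
    drawn-∈U (middle {x} x<W refl) _ =
      ∈-++⁺ʳ U₀ (∈-++⁺ˡ (subst (λ v → (+ v , + 1) ∈ U₁) (val-bits m x<W)
        (∈-map⁺ middleCell (∈-subsets (bits m x)))))
    drawn-∈U (top {x} x<W refl ¬i) _ =
      ∈-++⁺ʳ U₀ (∈-++⁺ʳ U₁ (subst (λ v → (+ v , + 2) ∈ U₂) (val-bits m x<W)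
        (∈-map⁺ topCell (∈-filter⁺ (¬? ∘ initialSegment?) (∈-subsets (bits m x)) ¬i))))

  open Polyominoes label U U-complete public

  curve-no-pinch : ∀ i x y → ¬ Pinch (polyomino i) x y
  curve-no-pinch zero = no-pinch-in-row (+ 1) (λ {c} c∈ → curve₀-row {c} (∈-polyomino⁻ c∈))
  curve-no-pinch (suc j) =
    no-pinch-downward (λ {x} {y} c∈ → map₁ ∈-polyomino⁺ (curve-suc-downward x y (∈-polyomino⁻ c∈)))
                      (λ {x} c∈ → ∉⊥ (subst (_ ∈ₛ_) (label-Frame (below x 0)) (∈-polyomino⁻ c∈)))

  isVennPolyomino : IsVennPolyomino polyomino
  isVennPolyomino =
    (λ i → isSimplePolyomino i (curve-nonempty i) (curve-connected i)
                               (curve-complement-connected i) (curve-no-pinch i)) ,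
    isVenn region-nonempty region-connected

  U-sound : 0 < m → ∀ {c} → c ∈ U → Nonempty (label c)
  U-sound 0<m c∈ with ∈-++⁻ U₀ c∈
  ... | inj₁ c∈₀ with ∈-map⁻ _ c∈₀
  ...   | x , x∈ , refl = subst Nonempty (sym (label-drawn (bottom (∈-upTo⁻ x∈) refl)))
                            (Nonempty-outside∷⁺ (threshold-suc-nonempty 0<m x))
  U-sound 0<m c∈ | inj₂ c∈₁₂ with ∈-++⁻ U₁ c∈₁₂
  ... | inj₁ c∈₁ with ∈-map⁻ _ c∈₁
  ...   | p , _ , refl = subst Nonempty (sym (label-drawn (middle (val<2^m p) (bits-val p)))) (zero , here)
  U-sound 0<m c∈ | inj₂ c∈₁₂ | inj₂ c∈₂ with ∈-map⁻ _ c∈₂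
  ...   | p , p∈ , refl = subst Nonempty (sym (label-drawn (top (val<2^m p) (bits-val p) ¬i)))
                            (Nonempty-outside∷⁺ (¬initial⇒nonempty ¬i))
    where
    ¬i : ¬ InitialSegment p
    ¬i = proj₂ (∈-filter⁻ (¬? ∘ initialSegment?) {xs = subsets m} p∈)

  U-unique : Unique U
  U-unique =
    Unique.++⁺ (Unique.map⁺ {f = bottomCell} (λ { refl → refl }) (Unique.upTo⁺ B))
      (Unique.++⁺ (Unique.map⁺ middleCell-injective (subsets-unique m))
                  (Unique.map⁺ topCell-injective (Unique.filter⁺ (¬? ∘ initialSegment?) (subsets-unique m)))
                  (map-Disjoint {f = middleCell} {g = topCell} (λ _ _ ())))
      U₀-disjoint
    where
    middleCell-injective : ∀ {p q} → middleCell p ≡ middleCell q → p ≡ q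
    middleCell-injective eq = val-injective (ℤ.+-injective (cong proj₁ eq))
    topCell-injective : ∀ {p q} → topCell p ≡ topCell q → p ≡ q
    topCell-injective eq = val-injective (ℤ.+-injective (cong proj₁ eq))
    U₀-disjoint : Disjoint U₀ (U₁ ++ U₂)
    U₀-disjoint (c∈₀ , c∈₁₂) with ∈-++⁻ U₁ c∈₁₂
    ... | inj₁ c∈₁ = map-Disjoint {f = bottomCell} {g = middleCell} (λ _ _ ()) (c∈₀ , c∈₁)
    ... | inj₂ c∈₂ = map-Disjoint {f = bottomCell} {g = topCell} (λ _ _ ()) (c∈₀ , c∈₂)

  length-U : length U + suc m ≡ B + 2 * W
  length-U = begin
    length (U₀ ++ U₁ ++ U₂) + suc m
      ≡⟨ cong (_+ suc m) (trans (length-++ U₀) (cong (λ t → length U₀ + t) (length-++ U₁))) ⟩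
    length U₀ + (length U₁ + length U₂) + suc m
      ≡⟨ cong₂ (λ a b → a + b + suc m) (trans (length-map _ (upTo B)) (length-upTo B))
               (cong₂ _+_ (trans (length-map _ (subsets m)) (length-subsets m))
                          (length-map _ (filter _ (subsets m)))) ⟩
    B + (W + tops) + suc m
      ≡⟨ trans (+-assoc B _ (suc m)) (cong (λ t → B + t) (+-assoc W tops (suc m))) ⟩
    B + (W + (tops + suc m))
      ≡⟨ cong (λ t → B + (W + t)) (trans (count-nonInitial m) (sym (+-identityʳ W))) ⟩
    B + 2 * W ∎
    where
    open ≡-Reasoning
    tops : ℕ
    tops = count m (¬? ∘ initialSegment?)

  area : 0 < m → HasArea polyomino (length U)
  area 0<m = hasArea U-unique (U-sound 0<m)

area-arithmetic : ∀ a k W → 0 < W → a + suc (suc (suc k)) ≡ pred W + k + 2 * W → a + 4 ≡ 2 * W + W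
area-arithmetic a k (suc w) _ eq = +-cancelʳ-≡ k (a + 4) (2 * suc w + suc w) (begin
  a + 4 + k                   ≡⟨ shift a k ⟩
  a + suc (suc (suc k)) + 1   ≡⟨ cong (_+ 1) eq ⟩
  w + k + 2 * suc w + 1       ≡⟨ regroup w k ⟩
  2 * suc w + suc w + k       ∎)
  where
  open ≡-Reasoning
  shift : ∀ a k → a + 4 + k ≡ a + suc (suc (suc k)) + 1
  shift = solve-∀
  regroup : ∀ w k → w + k + 2 * suc w + 1 ≡ 2 * suc w + suc w + k
  regroup = solve-∀

size-bound : ∀ a W → a + 4 ≡ 2 * W + W → 2 * a < 3 * (2 * W ∸ 1)
size-bound a zero eq = contradiction (m+n≡0⇒n≡0 a eq) λ ()
size-bound a (suc w) eq = subst (2 * a <_) 2a+5≡ (m<m+n (2 * a) (s≤s z≤n))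
  where
  open ≡-Reasoning
  2a+5≡ : 2 * a + 5 ≡ 3 * (2 * suc w ∸ 1)
  2a+5≡ = +-cancelʳ-≡ 3 (2 * a + 5) (3 * (2 * suc w ∸ 1)) (begin
    2 * a + 5 + 3             ≡⟨ double a ⟩
    2 * (a + 4)               ≡⟨ cong (2 *_) eq ⟩
    2 * (2 * suc w + suc w)   ≡⟨ triple w ⟩
    3 * (2 * suc w ∸ 1) + 3   ∎)
    where
    -- 2 * suc w ∸ 1 computes to w + (suc w + 0), which the ring solver can handle.
    double : ∀ a → 2 * a + 5 + 3 ≡ 2 * (a + 4)
    double = solve-∀
    triple : ∀ w → 2 * (2 * suc w + suc w) ≡ 3 * (w + (suc w + 0)) + 3
    triple = solve-∀

mainTheorem1 : ∀ (n : ℕ) → 3 ≤ n →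
    Σ (Fin n → List Cell) λ P →
      IsVennPolyomino P ×
      HasArea P (2 ^ n + 2 ^ (n ∸ 1) ∸ 4) ×
      2 * (2 ^ n + 2 ^ (n ∸ 1) ∸ 4) < 3 * (2 ^ n ∸ 1)
mainTheorem1 (suc (suc (suc k))) (s≤s (s≤s (s≤s _))) =
    polyomino
  , isVennPolyomino
  , subst (HasArea polyomino) area≡ (area (s≤s z≤n))
  , subst (λ a → 2 * a < 3 * (2 * W ∸ 1)) area≡ (size-bound (length U) W area+4)
  where
  -- With m = k + 2 and B = 2 ^ m - 1 + k the area B + 2 * 2 ^ m - (m + 1) is 3 * 2 ^ m - 4.
  open Drawing (suc (suc k)) (pred (2 ^ suc (suc k)) + k) (m≤m+n _ k)

  area+4 : length U + 4 ≡ 2 * W + W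
  area+4 = area-arithmetic (length U) k W (m^n>0 2 (suc (suc k))) length-U

  area≡ : length U ≡ 2 * W + W ∸ 4
  area≡ = trans (sym (m+n∸n≡m (length U) 4)) (cong (_∸ 4) area+4)
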